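{- For every integer $\gamma\ge 0$ there exists $g_0$ such that for every $g\ge g_0$ the following holds. Fix a set ${\rm R}_0$ and integers $u_1,u_1'$, and for an integer $u$ let ${\rm H}_u$ be the set of $(3,\gamma)$-hyperelliptic numerical semigroups ${\rm P}$ of genus $g$ with ${\rm P}_0={\rm R}_0$ and $u_1({\rm P})=u$. Let ${\rm S}\in{\rm H}_{u_1}$ and ${\rm T}\in{\rm H}_{u_1'}$ be such that $\#{\rm S}_{(u_1)_3}=\max\{\#{\rm P}_{(u_1)_3}: {\rm P}\in{\rm H}_{u_1}\}$ and $\#{\rm T}_{(u_1')_3}=\max\{\#{\rm P}_{(u_1')_3}: {\rm P}\in{\rm H}_{u_1'}\}$. If $\chi:=u_1-\big(g-3\gamma+1+\lfloor\frac{(g)_3}{2}\rfloor\big)<6\gamma$ and ${\rm S}_{(u_1)_3}\subsetneq{\rm T}_{(u_1')_3}$, then $\widetilde{I}_{\rm T}<\widetilde{I}_{\rm S}$.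
   Context: $\mathbb{N}=\{0,1,2,\dots\}$. A numerical semigroup is a subset ${\rm S}\subseteq\mathbb{N}$ containing $0$, closed under addition, with finite complement; its genus is $\#(\mathbb{N}\setminus{\rm S})$. For integers $N,\gamma\ge 0$, ${\rm S}$ is $(N,\gamma)$-hyperelliptic if (1) its first $\gamma$ positive elements $n_1<\dots<n_\gamma$ are multiples of $N$ and $n_\gamma=2\gamma N$, and (2) $(2\gamma+1)N\in{\rm S}$. $(x)_M$ denotes the residue of $x$ modulo $M$ in $\{0,\dots,M-1\}$; $[m]=\{1,\dots,m\}$. For a numerical semigroup ${\rm S}$ of genus $g$: ${\rm S}_i=\{s\in{\rm S}\cap[2g]: (s)_3=i\}$ for $i=0,1,2$; $u_1({\rm S})=\min\{s\in{\rm S}: (s)_3\neq 0\}$; and the inflection is $\widetilde{I}_{\rm S}=\sum_{s\in{\rm S}\cap[2g]}s$. -}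

module Defs where

open import Data.Nat using (ℕ; zero; suc; _+_; _*_; _≤_; _<_; _/_; _%_)
open import Data.Nat.Divisibility using (_∣_)
open import Data.Bool using (Bool; true; false; if_then_else_)
open import Data.Integer as ℤ using (ℤ; +_)
open import Data.Product using (Σ; ∃; _×_)
open import Relation.Binary.PropositionalEquality using (_≡_)
open import Relation.Nullary using (¬_)

record NumSemigroup : Set where
  field
    mem      : ℕ → Bool
    zero-mem : mem 0 ≡ true
    closed   : ∀ a b → mem a ≡ true → mem b ≡ true → mem (a + b) ≡ true
    cofinite : Σ ℕ λ N → ∀ n → N ≤ n → mem n ≡ true
open NumSemigroup public

_∈S_ : ℕ → NumSemigroup → Set
n ∈S S = mem S n ≡ true

gapsBelow : NumSemigroup → ℕ → ℕ
gapsBelow S zero    = 0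
gapsBelow S (suc n) = (if mem S n then 0 else 1) + gapsBelow S n

HasGenus : NumSemigroup → ℕ → Set
HasGenus S g = Σ ℕ λ N → (∀ n → N ≤ n → n ∈S S) × gapsBelow S N ≡ g

countPos : NumSemigroup → ℕ → ℕ
countPos S zero    = 0
countPos S (suc m) = (if mem S (suc m) then 1 else 0) + countPos S m

-- (N,γ)-hyperelliptic: the first γ positive elements are multiples of N
-- and the γ-th one is 2γN (i.e. exactly γ positive elements in [1,2γN], all
-- multiples of N, and 2γN ∈ S), and (2γ+1)N ∈ S.
Hyperelliptic : ℕ → ℕ → NumSemigroup → Set
Hyperelliptic N γ S =
  (countPos S (2 * γ * N) ≡ γ) ×
  (∀ s → 1 ≤ s → s ≤ 2 * γ * N → s ∈S S → N ∣ s) ×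
  (2 * γ * N) ∈S S ×
  ((2 * γ + 1) * N) ∈S S

InSub : NumSemigroup → ℕ → ℕ → ℕ → Set
InSub S g i s = (1 ≤ s) × (s ≤ 2 * g) × s ∈S S × (s % 3 ≡ i)

subB : NumSemigroup → ℕ → ℕ → ℕ → Bool
subB S g i zero    = false
subB S g i (suc s) with suc s Data.Nat.≤ᵇ (2 * g) | mem S (suc s) | suc s % 3 Data.Nat.≡ᵇ i
... | true | true | true = true
... | _    | _    | _    = false

countUpTo : (ℕ → Bool) → ℕ → ℕ
countUpTo f zero    = 0
countUpTo f (suc m) = (if f (suc m) then 1 else 0) + countUpTo f m

cardSub : NumSemigroup → ℕ → ℕ → ℕ
cardSub S g i = countUpTo (subB S g i) (2 * g)

sumUpTo : NumSemigroup → ℕ → ℕ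
sumUpTo S zero    = 0
sumUpTo S (suc m) = (if mem S (suc m) then suc m else 0) + sumUpTo S m

inflection : NumSemigroup → ℕ → ℕ
inflection S g = sumUpTo S (2 * g)

IsU1 : NumSemigroup → ℕ → Set
IsU1 S u = u ∈S S × ¬ (u % 3 ≡ 0) × (∀ s → s < u → s ∈S S → s % 3 ≡ 0)

InH : ℕ → ℕ → (ℕ → Set) → ℕ → NumSemigroup → Set
InH γ g R₀ u P =
  Hyperelliptic 3 γ P × HasGenus P g ×
  (∀ s → (InSub P g 0 s → R₀ s) × (R₀ s → InSub P g 0 s)) ×
  IsU1 P u

chi : ℕ → ℕ → ℕ → ℤ
chi γ g u = + u ℤ.- ((+ g ℤ.- + (3 * γ)) ℤ.+ + 1 ℤ.+ + ((g % 3) / 2))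

StrictSub : NumSemigroup → ℕ → NumSemigroup → ℕ → ℕ → Set
StrictSub S i T j g =
  (∀ s → InSub S g i s → InSub T g j s) × (∃ λ s → InSub T g j s × ¬ InSub S g i s)

module Submission where

-- Lemma 2.5.  For g large in terms of γ, if S, T are (3,γ)-hyperelliptic of genus g with
-- the same S₀, u₁ = u₁(S) satisfies χ < 6γ, and S_{(u₁)₃} ⊊ T_{(u₁')₃}, then Ĩ_T < Ĩ_S.
--
-- A semigroup of genus g contains every n ≥ 2g, so S and T both have exactly g
-- elements in [1,2g].  The exchange lemma compares two such equal-size subsets of [1,n]:
-- if every element of S∖T is ≥ β, n ≤ β + C, and some s₀ ∈ T∖S has s₀ + C² < β, then the
-- elements of T have the smaller sum.  To apply it with i = (u₁)₃:
--   * S and T agree on the class 0 and S_i ⊆ T_i, so S∖T lies in the third class j;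
--   * as 6γ, 6γ + 3 ∈ S, the semigroup S contains every multiple of 3 from K = 12γ² on and
--     every x ≡ y (mod 3) with x ≥ y + K once y ∈ S; so the gaps of S lie below K, u₁ + K
--     and y + K in the classes 0, i, j, and counting them gives y ≥ β := 3g − 3K − 6 − u₁
--     for every y ∈ S in the class j;
--   * s₀ ∈ T_i ∖ S_i is a gap of S in the class i, hence s₀ < u₁ + K;
--   * χ < 6γ means u₁ ≤ g + 3γ + 1, which makes these bounds fit once g ≥ g₀(γ).

open import Defs
open import Data.Nat using (ℕ; _≤_; _<_; _*_; _%_)
open import Data.Integer as ℤ using (+_)
open import Data.Product using (Σ)

open import Data.Bool using (true; false; if_then_else_)
import Data.Bool.Properties as Bool
open import Data.Empty using (⊥; ⊥-elim)
import Data.Integer.Properties as ℤₚ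
import Data.Integer.Tactic.RingSolver as ℤSolver
open import Data.List using (_∷_; [])
open import Data.Nat
open import Data.Nat.DivMod
open import Data.Nat.Divisibility using (_∣_; divides; m%n≡0⇒n∣m)
open import Data.Nat.Properties
open import Algebra.Properties.CommutativeSemigroup +-commutativeSemigroup
  using (interchange; x∙yz≈y∙xz; x∙yz≈y∙zx; xy∙z≈xz∙y)
open import Data.Nat.Tactic.RingSolver using (solve; solve-∀)
open import Data.Product using (_×_; _,_; proj₁; proj₂)
open import Data.Sum using (_⊎_; inj₁; inj₂)
open import Function using (_∘_)
open import Relation.Binary.PropositionalEquality
open import Relation.Nullary using (yes; no; contradiction)
open import Relation.Nullary.Reflects using (Reflects; ofʸ; ofⁿ; fromEquivalence)

sumBelow : (ℕ → ℕ) → ℕ → ℕ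
sumBelow f zero    = 0
sumBelow f (suc n) = f n + sumBelow f n

sumBelow-cong : ∀ {f h : ℕ → ℕ} n → (∀ k → k < n → f k ≡ h k) → sumBelow f n ≡ sumBelow h n
sumBelow-cong zero    f≡h = refl
sumBelow-cong (suc n) f≡h =
  cong₂ _+_ (f≡h n ≤-refl) (sumBelow-cong n (λ k k<n → f≡h k (m<n⇒m<1+n k<n)))

sumBelow-mono : ∀ {f h : ℕ → ℕ} n → (∀ k → k < n → f k ≤ h k) → sumBelow f n ≤ sumBelow h n
sumBelow-mono zero    f≤h = z≤n
sumBelow-mono (suc n) f≤h =
  +-mono-≤ (f≤h n ≤-refl) (sumBelow-mono n (λ k k<n → f≤h k (m<n⇒m<1+n k<n)))

sumBelow-mono-margin : ∀ {f h : ℕ → ℕ} {d k₀} n → (∀ k → k < n → f k ≤ h k) →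
                       k₀ < n → f k₀ + d ≤ h k₀ → sumBelow f n + d ≤ sumBelow h n
sumBelow-mono-margin {f} {h} {d} (suc n) f≤h k₀<1+n margin with m<1+n⇒m<n∨m≡n k₀<1+n
... | inj₂ refl = begin
  f n + sumBelow f n + d   ≡⟨ xy∙z≈xz∙y (f n) (sumBelow f n) d ⟩
  f n + d + sumBelow f n   ≤⟨ +-mono-≤ margin (sumBelow-mono n (λ k k<n → f≤h k (m<n⇒m<1+n k<n))) ⟩
  h n + sumBelow h n       ∎
  where open ≤-Reasoning
... | inj₁ k₀<n = begin
  f n + sumBelow f n + d   ≡⟨ +-assoc (f n) (sumBelow f n) d ⟩
  f n + (sumBelow f n + d) ≤⟨ +-mono-≤ (f≤h n ≤-refl)
                               (sumBelow-mono-margin n (λ k k<n → f≤h k (m<n⇒m<1+n k<n)) k₀<n margin) ⟩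
  h n + sumBelow h n       ∎
  where open ≤-Reasoning

sumBelow-monoʳ : ∀ f {m n} → m ≤ n → sumBelow f m ≤ sumBelow f n
sumBelow-monoʳ f {n = zero} z≤n = ≤-refl
sumBelow-monoʳ f {m} {suc n} m≤1+n with m≤n⇒m<n∨m≡n m≤1+n
... | inj₂ refl    = ≤-refl
... | inj₁ m<1+n   = ≤-trans (sumBelow-monoʳ f (m<1+n⇒m≤n m<1+n)) (m≤n+m _ (f n))

sumBelow-+ : ∀ f h n → sumBelow (λ k → f k + h k) n ≡ sumBelow f n + sumBelow h n
sumBelow-+ f h zero    = refl
sumBelow-+ f h (suc n) = trans (cong (_+_ (f n + h n)) (sumBelow-+ f h n))
                               (interchange (f n) (h n) (sumBelow f n) (sumBelow h n))

sumBelow-* : ∀ c f n → sumBelow (λ k → c * f k) n ≡ c * sumBelow f n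
sumBelow-* c f zero    = sym (*-zeroʳ c)
sumBelow-* c f (suc n) = trans (cong (_+_ (c * f n)) (sumBelow-* c f n)) (sym (*-distribˡ-+ c (f n) _))

sumBelow-one : ∀ n → sumBelow (λ _ → 1) n ≡ n
sumBelow-one zero    = refl
sumBelow-one (suc n) = cong suc (sumBelow-one n)

sumBelow-shift : ∀ h n → sumBelow h (suc n) ≡ h 0 + sumBelow (h ∘ suc) n
sumBelow-shift h zero    = refl
sumBelow-shift h (suc n) = trans (cong (_+_ (h (suc n))) (sumBelow-shift h n))
                                 (x∙yz≈y∙xz (h (suc n)) (h 0) (sumBelow (h ∘ suc) n))

sumBelow-reverse : ∀ h n → sumBelow (λ k → h (n ∸ k)) (suc n) ≡ sumBelow h (suc n)
sumBelow-reverse h zero    = refl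
sumBelow-reverse h (suc n) = begin
  h (suc n ∸ suc n) + sumBelow (λ k → h (suc n ∸ k)) (suc n)
    ≡⟨ cong₂ _+_ (cong h (n∸n≡0 n))
                 (sumBelow-cong (suc n) (λ k k<1+n → cong h (+-∸-assoc 1 (m<1+n⇒m≤n k<1+n)))) ⟩
  h 0 + sumBelow (λ k → h (suc (n ∸ k))) (suc n)   ≡⟨ cong (_+_ (h 0)) (sumBelow-reverse (h ∘ suc) n) ⟩
  h 0 + sumBelow (h ∘ suc) (suc n)                 ≡⟨ sumBelow-shift h (suc n) ⟨
  sumBelow h (suc (suc n))                         ∎
  where open ≡-Reasoning

memInd : NumSemigroup → ℕ → ℕ
memInd S s = if mem S s then 1 else 0

gapInd : NumSemigroup → ℕ → ℕ
gapInd S s = if mem S s then 0 else 1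

value : NumSemigroup → ℕ → ℕ
value S s = if mem S s then s else 0

mem-clash : ∀ S {s} → s ∈S S → mem S s ≡ false → ⊥
mem-clash S s∈S s∉S = Bool.not-¬ s∈S s∉S

gapsBelow≡sum : ∀ S m → gapsBelow S m ≡ sumBelow (gapInd S) m
gapsBelow≡sum S zero    = refl
gapsBelow≡sum S (suc m) = cong (_+_ (gapInd S m)) (gapsBelow≡sum S m)

countPos≡sum : ∀ S n → countPos S n ≡ sumBelow (λ k → memInd S (suc k)) n
countPos≡sum S zero    = refl
countPos≡sum S (suc n) = cong (_+_ (memInd S (suc n))) (countPos≡sum S n)

sumUpTo≡sum : ∀ S n → sumUpTo S n ≡ sumBelow (λ k → value S (suc k)) n
sumUpTo≡sum S zero    = refl
sumUpTo≡sum S (suc n) = cong (_+_ (value S (suc n))) (sumUpTo≡sum S n)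

gapsBelow-stable : ∀ S {M} → (∀ n → M ≤ n → n ∈S S) → ∀ t → gapsBelow S (t + M) ≡ gapsBelow S M
gapsBelow-stable S all zero = refl
gapsBelow-stable S {M} all (suc t) rewrite all (t + M) (m≤n+m M t) = gapsBelow-stable S all t

gapsBelow-genus : ∀ S {g M} → HasGenus S g → (∀ n → M ≤ n → n ∈S S) → gapsBelow S M ≡ g
gapsBelow-genus S {g} {M} (N , allN , gapsN) allM = begin
  gapsBelow S M       ≡⟨ gapsBelow-stable S allM N ⟨
  gapsBelow S (N + M) ≡⟨ cong (gapsBelow S) (+-comm N M) ⟩
  gapsBelow S (M + N) ≡⟨ gapsBelow-stable S allN M ⟩
  gapsBelow S N       ≡⟨ gapsN ⟩
  g                   ∎
  where open ≡-Reasoning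

gapsBelow≤genus : ∀ S {g} → HasGenus S g → ∀ m → gapsBelow S m ≤ g
gapsBelow≤genus S {g} hg@(N , allN , _) m = begin
  gapsBelow S m               ≡⟨ gapsBelow≡sum S m ⟩
  sumBelow (gapInd S) m       ≤⟨ sumBelow-monoʳ (gapInd S) (m≤m+n m N) ⟩
  sumBelow (gapInd S) (m + N) ≡⟨ gapsBelow≡sum S (m + N) ⟨
  gapsBelow S (m + N)         ≡⟨ gapsBelow-genus S hg (λ n m+N≤n → allN n (≤-trans (m≤n+m N m) m+N≤n)) ⟩
  g                           ∎
  where open ≤-Reasoning

elements+gaps : ∀ S m → sumBelow (memInd S) m + gapsBelow S m ≡ m
elements+gaps S m = begin
  sumBelow (memInd S) m + gapsBelow S m         ≡⟨ cong (_+_ (sumBelow (memInd S) m)) (gapsBelow≡sum S m) ⟩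
  sumBelow (memInd S) m + sumBelow (gapInd S) m ≡⟨ sumBelow-+ (memInd S) (gapInd S) m ⟨
  sumBelow (λ k → memInd S k + gapInd S k) m    ≡⟨ sumBelow-cong m (λ k _ → element-or-gap k) ⟩
  sumBelow (λ _ → 1) m                          ≡⟨ sumBelow-one m ⟩
  m                                             ∎
  where
  open ≡-Reasoning
  element-or-gap : ∀ k → memInd S k + gapInd S k ≡ 1
  element-or-gap k with mem S k
  ... | true  = refl
  ... | false = refl

-- If n is a gap, k and n ∸ k are never both elements, since their sum n would be one.
gap-pairs : ∀ S {n} → mem S n ≡ false → ∀ k → k ≤ n → memInd S k + memInd S (n ∸ k) ≤ 1
gap-pairs S {n} n∉S k k≤n with mem S k in k∈S | mem S (n ∸ k) in n-k∈S
... | false | false = z≤n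
... | false | true  = ≤-refl
... | true  | false = ≤-refl
... | true  | true  = ⊥-elim (mem-clash S n∈S n∉S)
  where
  n∈S : n ∈S S
  n∈S = subst (_∈S S) (m+[n∸m]≡n k≤n) (closed S k (n ∸ k) k∈S n-k∈S)

elements-below-gap : ∀ S {n} → mem S n ≡ false →
                     sumBelow (memInd S) (suc n) + sumBelow (memInd S) (suc n) ≤ suc n
elements-below-gap S {n} n∉S = begin
  X + X                                                   ≡⟨ cong (_+_ X) (sumBelow-reverse (memInd S) n) ⟨
  X + sumBelow (λ k → memInd S (n ∸ k)) (suc n)           ≡⟨ sumBelow-+ (memInd S) _ (suc n) ⟨
  sumBelow (λ k → memInd S k + memInd S (n ∸ k)) (suc n)
    ≤⟨ sumBelow-mono (suc n) (λ k k<1+n → gap-pairs S n∉S k (m<1+n⇒m≤n k<1+n)) ⟩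
  sumBelow (λ _ → 1) (suc n)                              ≡⟨ sumBelow-one (suc n) ⟩
  suc n                                                   ∎
  where
  open ≤-Reasoning
  X = sumBelow (memInd S) (suc n)

large-in : ∀ S {g} → HasGenus S g → ∀ n → 2 * g ≤ n → n ∈S S
large-in S {g} hg n 2g≤n with mem S n in n∈S?
... | true  = refl
... | false = contradiction 2g≤n (<⇒≱ n<2g)
  where
  X = sumBelow (memInd S) (suc n)
  1+n≤X+g : suc n ≤ X + g
  1+n≤X+g = subst (_≤ X + g) (elements+gaps S (suc n)) (+-monoʳ-≤ X (gapsBelow≤genus S hg (suc n)))
  regroup : ∀ x y → (x + y) + (x + y) ≡ (x + x) + 2 * y
  regroup = solve-∀
  n<2g : n < 2 * g
  n<2g = +-cancelˡ-≤ (suc n) _ _ (begin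
    suc n + suc n     ≤⟨ +-mono-≤ 1+n≤X+g 1+n≤X+g ⟩
    (X + g) + (X + g) ≡⟨ regroup X g ⟩
    (X + X) + 2 * g   ≤⟨ +-monoˡ-≤ (2 * g) (elements-below-gap S n∈S?) ⟩
    suc n + 2 * g     ∎)
    where open ≤-Reasoning

-- The elements of [1,m] and the gaps in [0,m] together number m (as 0 ∈ S).
countPos+gaps : ∀ S m → countPos S m + gapsBelow S (suc m) ≡ m
countPos+gaps S zero rewrite zero-mem S = refl
countPos+gaps S (suc m) with mem S (suc m)
... | true  = cong suc (countPos+gaps S m)
... | false = trans (+-suc (countPos S m) (gapsBelow S (suc m))) (cong suc (countPos+gaps S m))

countPos-genus : ∀ S {g} → HasGenus S g → countPos S (2 * g) ≡ g
countPos-genus S {g} hg = +-cancelʳ-≡ g (countPos S (2 * g)) g (begin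
  countPos S (2 * g) + g                          ≡⟨ cong (_+_ (countPos S (2 * g))) gaps≡g ⟨
  countPos S (2 * g) + gapsBelow S (suc (2 * g))  ≡⟨ countPos+gaps S (2 * g) ⟩
  2 * g                                           ≡⟨ cong (_+_ g) (+-identityʳ g) ⟩
  g + g                                           ∎)
  where
  open ≡-Reasoning
  gaps≡g : gapsBelow S (suc (2 * g)) ≡ g
  gaps≡g = gapsBelow-genus S hg (λ n 2g<n → large-in S hg n (<⇒≤ 2g<n))

above : ℕ → ℕ → ℕ
above b k = if b ≤ᵇ k then 1 else 0

sumBelow-above : ∀ b n → sumBelow (above b) n ≡ n ∸ b
sumBelow-above b zero = sym (0∸n≡0 b)
sumBelow-above b (suc n) with b ≤ᵇ n | ≤ᵇ-reflects-≤ b n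
... | true  | ofʸ b≤n = trans (cong suc (sumBelow-above b n)) (sym (+-∸-assoc 1 b≤n))
... | false | ofⁿ b≰n = trans (sumBelow-above b n) (trans (m≤n⇒m∸n≡0 (<⇒≤ n<b)) (sym (m≤n⇒m∸n≡0 n<b)))
  where n<b = ≰⇒> b≰n

within-window : ∀ {n} β C k → suc k ≤ n → n ≤ β + C → suc k ≤ β + C * above β k
within-window β C k k<n n≤β+C with β ≤ᵇ k | ≤ᵇ-reflects-≤ β k
... | true  | ofʸ _   = ≤-trans (≤-trans k<n n≤β+C) (≤-reflexive (cong (_+_ β) (sym (*-identityʳ C))))
... | false | ofⁿ β≰k = ≤-trans (≰⇒> β≰k) (m≤m+n β _)

cancel-margin : ∀ {a b m c} → a + m + suc c ≤ b + m + c → a < b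
cancel-margin {a} {b} {m} {c} le = +-cancelˡ-≤ (m + c) (suc a) b (begin
  m + c + suc a ≡⟨ solve (a ∷ m ∷ c ∷ []) ⟩
  a + m + suc c ≤⟨ le ⟩
  b + m + c     ≡⟨ solve (b ∷ m ∷ c ∷ []) ⟩
  m + c + b     ∎)
  where open ≤-Reasoning

-- Pointwise s·[s∈T] + β·[s∈S] ≤ s·[s∈S] + β·[s∈T] + C·[s>β],
-- with margin C² + 1 at s₀; summed, the window (β, n] contributes at most C·C.
exchange : ∀ (S T : NumSemigroup) n β C s₀ →
  countPos S n ≡ countPos T n →
  (∀ s → 1 ≤ s → s ≤ n → s ∈S S → mem T s ≡ false → β ≤ s) →
  n ≤ β + C →
  1 ≤ s₀ → s₀ ≤ n → s₀ ∈S T → mem S s₀ ≡ false → s₀ + C * C < β →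
  sumUpTo T n < sumUpTo S n
exchange S T n β C (suc k₀) |S|≡|T| S∖T≥β n≤β+C (s≤s z≤n) s₀≤n s₀∈T s₀∉S s₀-small =
  cancel-margin (begin
    sumUpTo T n + β * countPos T n + suc (C * C) ≡⟨ cong (λ c → sumUpTo T n + β * c + _) |S|≡|T| ⟨
    sumUpTo T n + β * countPos S n + suc (C * C) ≡⟨ cong (_+ suc (C * C)) sum-lhs ⟨
    sumBelow lhs n + suc (C * C)                 ≤⟨ sumBelow-mono-margin n pointwise s₀≤n at-s₀ ⟩
    sumBelow rhs n                               ≡⟨ sum-rhs ⟩
    sumUpTo S n + β * countPos T n + C * (n ∸ β) ≤⟨ +-monoʳ-≤ _ (*-monoʳ-≤ C (m≤n+o⇒m∸n≤o n β n≤β+C)) ⟩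
    sumUpTo S n + β * countPos T n + C * C       ∎)
  where
  open ≤-Reasoning
  lhs rhs : ℕ → ℕ
  lhs k = value T (suc k) + β * memInd S (suc k)
  rhs k = value S (suc k) + β * memInd T (suc k) + C * above β k

  pointwise : ∀ k → k < n → lhs k ≤ rhs k
  pointwise k k<n with mem S (suc k) in s∈S? | mem T (suc k) in s∈T?
  ... | true  | true  = m≤m+n _ _
  ... | false | false = m≤m+n _ _
  ... | true  | false = begin
    β * 1                            ≡⟨ *-identityʳ β ⟩
    β                                ≤⟨ S∖T≥β (suc k) (s≤s z≤n) k<n s∈S? s∈T? ⟩
    suc k                            ≤⟨ m≤m+n (suc k) (β * 0) ⟩
    suc k + β * 0                    ≤⟨ m≤m+n _ _ ⟩
    suc k + β * 0 + C * above β k    ∎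
  ... | false | true  = begin
    suc k + β * 0                    ≡⟨ cong (_+_ (suc k)) (*-zeroʳ β) ⟩
    suc k + 0                        ≡⟨ +-identityʳ (suc k) ⟩
    suc k                            ≤⟨ within-window β C k k<n n≤β+C ⟩
    β + C * above β k                ≡⟨ cong (_+ C * above β k) (*-identityʳ β) ⟨
    β * 1 + C * above β k            ∎

  at-s₀ : lhs k₀ + suc (C * C) ≤ rhs k₀
  at-s₀ rewrite s₀∉S | s₀∈T = begin
    suc k₀ + β * 0 + suc (C * C)     ≡⟨ cong (λ z → suc k₀ + z + suc (C * C)) (*-zeroʳ β) ⟩
    suc k₀ + 0 + suc (C * C)         ≡⟨ cong (_+ suc (C * C)) (+-identityʳ (suc k₀)) ⟩
    suc k₀ + suc (C * C)             ≡⟨ +-suc (suc k₀) (C * C) ⟩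
    suc (suc k₀ + C * C)             ≤⟨ s₀-small ⟩
    β                                ≡⟨ *-identityʳ β ⟨
    β * 1                            ≤⟨ m≤m+n _ _ ⟩
    β * 1 + C * above β k₀           ∎

  sum-lhs : sumBelow lhs n ≡ sumUpTo T n + β * countPos S n
  sum-lhs = trans (sumBelow-+ (value T ∘ suc) (λ k → β * memInd S (suc k)) n)
    (cong₂ _+_ (sym (sumUpTo≡sum T n))
               (trans (sumBelow-* β (memInd S ∘ suc) n) (cong (β *_) (sym (countPos≡sum S n)))))

  sum-rhs : sumBelow rhs n ≡ sumUpTo S n + β * countPos T n + C * (n ∸ β)
  sum-rhs = trans (sumBelow-+ (λ k → value S (suc k) + β * memInd T (suc k)) (λ k → C * above β k) n)
    (cong₂ _+_
      (trans (sumBelow-+ (value S ∘ suc) (λ k → β * memInd T (suc k)) n)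
        (cong₂ _+_ (sym (sumUpTo≡sum S n))
                   (trans (sumBelow-* β (memInd T ∘ suc) n) (cong (β *_) (sym (countPos≡sum T n))))))
      (trans (sumBelow-* C (above β) n) (cong (C *_) (sumBelow-above β n))))

≡ᵇ-reflects-≡ : ∀ m n → Reflects (m ≡ n) (m ≡ᵇ n)
≡ᵇ-reflects-≡ m n = fromEquivalence (≡ᵇ⇒≡ m n) (≡⇒≡ᵇ m n)

classInd : ℕ → ℕ → ℕ
classInd r x = if x % 3 ≡ᵇ r then 1 else 0

classCount : ℕ → ℕ → ℕ
classCount r = sumBelow (classInd r)

mod3-period : ∀ x → suc (suc (suc x)) % 3 ≡ x % 3
mod3-period x = trans (cong (_% 3) (+-comm 3 x)) ([m+n]%n≡m%n x 3)

three-consecutive : ∀ r x → classInd r (2 + x) + (classInd r (1 + x) + classInd r x) ≤ 1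
three-consecutive 0 zero = ≤-refl
three-consecutive 1 zero = ≤-refl
three-consecutive 2 zero = ≤-refl
three-consecutive (suc (suc (suc r))) zero = z≤n
three-consecutive r (suc x) = begin
  classInd r (3 + x) + (classInd r (2 + x) + classInd r (1 + x))
    ≡⟨ cong (λ y → (if y ≡ᵇ r then 1 else 0) + (classInd r (2 + x) + classInd r (1 + x))) (mod3-period x) ⟩
  classInd r x + (classInd r (2 + x) + classInd r (1 + x))
    ≡⟨ x∙yz≈y∙zx (classInd r x) (classInd r (2 + x)) (classInd r (1 + x)) ⟩
  classInd r (2 + x) + (classInd r (1 + x) + classInd r x)
    ≤⟨ three-consecutive r x ⟩
  1 ∎
  where open ≤-Reasoning

classCount-step : ∀ r L → classCount r (3 + L) ≤ 1 + classCount r L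
classCount-step r L = begin
  a + (b + (c + d)) ≡⟨ cong (_+_ a) (+-assoc b c d) ⟨
  a + (b + c + d)   ≡⟨ +-assoc a (b + c) d ⟨
  a + (b + c) + d   ≤⟨ +-monoˡ-≤ d (three-consecutive r L) ⟩
  1 + d             ∎
  where
  open ≤-Reasoning
  a = classInd r (2 + L)
  b = classInd r (1 + L)
  c = classInd r L
  d = classCount r L

classCount-bound : ∀ r L → 3 * classCount r L ≤ L + 2
classCount-bound r 0 = z≤n
classCount-bound r 1 = *-monoʳ-≤ 3 (≤-trans (sumBelow-monoʳ (classInd r) {1} {3} (s≤s z≤n)) (classCount-step r 0))
classCount-bound r 2 =
  ≤-trans (*-monoʳ-≤ 3 (≤-trans (sumBelow-monoʳ (classInd r) {2} {3} (s≤s (s≤s z≤n))) (classCount-step r 0)))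
          (n≤1+n 3)
classCount-bound r (suc (suc (suc L))) = begin
  3 * classCount r (3 + L)  ≤⟨ *-monoʳ-≤ 3 (classCount-step r L) ⟩
  3 * (1 + classCount r L)  ≡⟨ *-distribˡ-+ 3 1 (classCount r L) ⟩
  3 + 3 * classCount r L    ≤⟨ +-monoʳ-≤ 3 (classCount-bound r L) ⟩
  3 + (L + 2)               ∎
  where open ≤-Reasoning

third-residue : ∀ {r i} → r < 3 → i < 3 → r ≢ 0 → i ≢ 0 → r ≢ i → r ≡ 3 ∸ i
third-residue {0}     _ _ r≢0 _   _   = contradiction refl r≢0
third-residue {_} {0} _ _ _   i≢0 _   = contradiction refl i≢0
third-residue {1} {1} _ _ _   _   r≢i = contradiction refl r≢i
third-residue {1} {2} _ _ _   _   _   = refl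
third-residue {2} {1} _ _ _   _   _   = refl
third-residue {2} {2} _ _ _   _   r≢i = contradiction refl r≢i
third-residue {suc (suc (suc _))} (s≤s (s≤s (s≤s ()))) _ _ _ _
third-residue {1} {suc (suc (suc _))} _ (s≤s (s≤s (s≤s ()))) _ _ _
third-residue {2} {suc (suc (suc _))} _ (s≤s (s≤s (s≤s ()))) _ _ _

restrict : ℕ → (ℕ → ℕ) → ℕ → ℕ
restrict L f x = if x <ᵇ L then f x else 0

sumBelow-restrict : ∀ L f N → sumBelow (restrict L f) N ≡ sumBelow f (N ⊓ L)
sumBelow-restrict L f zero = refl
sumBelow-restrict L f (suc N) with N <ᵇ L | <ᵇ-reflects-< N L
... | true  | ofʸ N<L = trans (cong (_+_ (f N)) (trans (sumBelow-restrict L f N)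
                                            (cong (sumBelow f) (m≤n⇒m⊓n≡m (<⇒≤ N<L)))))
                      (cong (sumBelow f) (sym (m≤n⇒m⊓n≡m N<L)))
... | false | ofⁿ N≮L = trans (sumBelow-restrict L f N)
                      (cong (sumBelow f) (trans (m≥n⇒m⊓n≡n L≤N) (sym (m≥n⇒m⊓n≡n (m≤n⇒m≤1+n L≤N)))))
  where L≤N = ≮⇒≥ N≮L

sumBelow-restrict≤ : ∀ L f N → sumBelow (restrict L f) N ≤ sumBelow f L
sumBelow-restrict≤ L f N =
  ≤-trans (≤-reflexive (sumBelow-restrict L f N)) (sumBelow-monoʳ f (m⊓n≤n N L))

band : ℕ → ℕ → ℕ → ℕ
band r L = restrict L (classInd r)

band-hit : ∀ {r L x} → x % 3 ≡ r → x < L → 1 ≤ band r L x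
band-hit {r} {L} {x} x≡r x<L with x <ᵇ L | <ᵇ-reflects-< x L | x % 3 ≡ᵇ r | ≡ᵇ-reflects-≡ (x % 3) r
... | true  | _        | true  | _        = ≤-refl
... | true  | _        | false | ofⁿ x≢r = contradiction x≡r x≢r
... | false | ofⁿ x≮L | _     | _        = contradiction x<L x≮L

genus≤classCounts : ∀ S {g} p q r A B D → HasGenus S g →
  (∀ x → mem S x ≡ false → (x % 3 ≡ p × x < A) ⊎ (x % 3 ≡ q × x < B) ⊎ (x % 3 ≡ r × x < D)) →
  g ≤ classCount p A + classCount q B + classCount r D
genus≤classCounts S {g} p q r A B D (N , _ , gapsN) covered = begin
  g                                  ≡⟨ trans (sym (gapsBelow≡sum S N)) gapsN ⟨
  sumBelow (gapInd S) N              ≤⟨ sumBelow-mono N (λ x _ → gap-in-band x) ⟩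
  sumBelow (λ x → band p A x + band q B x + band r D x) N
    ≡⟨ trans (sumBelow-+ (λ x → band p A x + band q B x) (band r D) N)
             (cong (_+ sumBelow (band r D) N) (sumBelow-+ (band p A) (band q B) N)) ⟩
  sumBelow (band p A) N + sumBelow (band q B) N + sumBelow (band r D) N
    ≤⟨ +-mono-≤ (+-mono-≤ (sumBelow-restrict≤ A (classInd p) N) (sumBelow-restrict≤ B (classInd q) N))
                (sumBelow-restrict≤ D (classInd r) N) ⟩
  classCount p A + classCount q B + classCount r D ∎
  where
  open ≤-Reasoning
  gap-in-band : ∀ x → gapInd S x ≤ band p A x + band q B x + band r D x
  gap-in-band x with mem S x in x∈S?
  ... | true  = z≤n
  ... | false with covered x x∈S?
  ...   | inj₁ (x≡p , x<A)        = ≤-trans (band-hit x≡p x<A)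
                                      (≤-trans (m≤m+n (band p A x) (band q B x)) (m≤m+n _ (band r D x)))
  ...   | inj₂ (inj₁ (x≡q , x<B)) = ≤-trans (band-hit x≡q x<B)
                                      (≤-trans (m≤n+m (band q B x) (band p A x)) (m≤m+n _ (band r D x)))
  ...   | inj₂ (inj₂ (x≡r , x<D)) = ≤-trans (band-hit x≡r x<D) (m≤n+m (band r D x) _)

genus-by-classes : ∀ S {g} p q r A B D → HasGenus S g →
  (∀ x → mem S x ≡ false → (x % 3 ≡ p × x < A) ⊎ (x % 3 ≡ q × x < B) ⊎ (x % 3 ≡ r × x < D)) →
  3 * g ≤ A + B + D + 6
genus-by-classes S {g} p q r A B D hg covered = begin
  3 * g                                                      ≤⟨ *-monoʳ-≤ 3 (genus≤classCounts S p q r A B D hg covered) ⟩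
  3 * (classCount p A + classCount q B + classCount r D)
    ≡⟨ trans (*-distribˡ-+ 3 (classCount p A + classCount q B) (classCount r D))
             (cong (_+ 3 * classCount r D) (*-distribˡ-+ 3 (classCount p A) (classCount q B))) ⟩
  3 * classCount p A + 3 * classCount q B + 3 * classCount r D
    ≤⟨ +-mono-≤ (+-mono-≤ (classCount-bound p A) (classCount-bound q B)) (classCount-bound r D) ⟩
  (A + 2) + (B + 2) + (D + 2)                                ≡⟨ solve (A ∷ B ∷ D ∷ []) ⟩
  A + B + D + 6                                              ∎
  where open ≤-Reasoning

multiple-in : ∀ S {x} → x ∈S S → ∀ p → (p * x) ∈S S
multiple-in S x∈S zero    = zero-mem S
multiple-in S x∈S (suc p) = closed S _ _ x∈S (multiple-in S x∈S p)

-- If e·d and (e+1)·d lie in S then so does m·d for every m ≥ e²: writing m = r + q·e with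
-- r < e ≤ q, one has m·d = (q − r)·(e·d) + r·((e+1)·d).
consecutive-multiples : ∀ S e d → (e * d) ∈S S → ((e + 1) * d) ∈S S →
                        ∀ m → e * e ≤ m → (m * d) ∈S S
consecutive-multiples S zero d _ d∈S m _ =
  subst (_∈S S) (cong (m *_) (+-identityʳ d)) (multiple-in S d∈S m)
consecutive-multiples S e@(suc _) d ed∈S e+1d∈S m e²≤m =
  subst (_∈S S) decomposition (closed S _ _ (multiple-in S ed∈S (q ∸ r)) (multiple-in S e+1d∈S r))
  where
  q = m / e
  r = m % e
  r≤q : r ≤ q
  r≤q = ≤-trans (<⇒≤ (m%n<n m e)) (subst (_≤ q) (m*n/n≡m e e) (/-monoˡ-≤ e e²≤m))
  regroup : ∀ k r e d → k * (e * d) + r * ((e + 1) * d) ≡ (r + (r + k) * e) * d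
  regroup = solve-∀
  decomposition : (q ∸ r) * (e * d) + r * ((e + 1) * d) ≡ m * d
  decomposition = begin
    (q ∸ r) * (e * d) + r * ((e + 1) * d) ≡⟨ regroup (q ∸ r) r e d ⟩
    (r + (r + (q ∸ r)) * e) * d           ≡⟨ cong (λ t → (r + t * e) * d) (m+[n∸m]≡n r≤q) ⟩
    (r + q * e) * d                       ≡⟨ cong (_* d) (m≡m%n+[m/n]*n m e) ⟨
    m * d                                 ∎
    where open ≡-Reasoning

divisible-in : ∀ S e d .{{_ : NonZero d}} → (e * d) ∈S S → ((e + 1) * d) ∈S S →
               ∀ x → d ∣ x → d * (e * e) ≤ x → x ∈S S
divisible-in S e d ed∈S e+1d∈S .(m * d) (divides m refl) bound =
  consecutive-multiples S e d ed∈S e+1d∈S m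
    (*-cancelʳ-≤ (e * e) m d (subst (_≤ m * d) (*-comm d (e * e)) bound))

≡-mod⇒∣∸ : ∀ {x y d} .{{_ : NonZero d}} → x % d ≡ y % d → d ∣ x ∸ y
≡-mod⇒∣∸ {x} {y} {d} x≡y = divides (x / d ∸ y / d) (begin
  x ∸ y                                      ≡⟨ cong₂ _∸_ (m≡m%n+[m/n]*n x d) (m≡m%n+[m/n]*n y d) ⟩
  (x % d + x / d * d) ∸ (y % d + y / d * d)  ≡⟨ cong (λ t → (t + x / d * d) ∸ (y % d + y / d * d)) x≡y ⟩
  (y % d + x / d * d) ∸ (y % d + y / d * d)  ≡⟨ [m+n]∸[m+o]≡n∸o (y % d) (x / d * d) (y / d * d) ⟩
  x / d * d ∸ y / d * d                      ≡⟨ *-distribʳ-∸ d (x / d) (y / d) ⟨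
  (x / d ∸ y / d) * d                        ∎)
  where open ≡-Reasoning

same-residue-in : ∀ S e d .{{_ : NonZero d}} → (e * d) ∈S S → ((e + 1) * d) ∈S S →
                  ∀ {x y} → y ∈S S → x % d ≡ y % d → y + d * (e * e) ≤ x → x ∈S S
same-residue-in S e d ed∈S e+1d∈S {x} {y} y∈S x≡y bound =
  subst (_∈S S) (m+[n∸m]≡n y≤x) (closed S y (x ∸ y) y∈S
    (divisible-in S e d ed∈S e+1d∈S (x ∸ y) (≡-mod⇒∣∸ x≡y)
      (m+n≤o⇒m≤o∸n (d * (e * e)) (subst (_≤ x) (+-comm y _) bound))))
  where y≤x = ≤-trans (m≤m+n y _) bound

-- K e = 3e²: from K e on, every multiple of 3 lies in a semigroup containing 3e and 3e + 3.
K : ℕ → ℕ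
K e = 3 * (e * e)

-- In a semigroup of genus g containing 3e, 3e + 3 and an element a ≢ 0 (mod 3), every element
-- y of the third residue class satisfies 3g ≤ 3K + 6 + a + y: the gaps lie below K, a + K and
-- y + K in the classes 0, (a)₃ and (y)₃.
third-class-large : ∀ S {g} e {a y} → HasGenus S g → (e * 3) ∈S S → ((e + 1) * 3) ∈S S →
  a ∈S S → a % 3 ≢ 0 → y ∈S S → y % 3 ≢ 0 → y % 3 ≢ a % 3 → 3 * g ≤ 3 * K e + 6 + a + y
third-class-large S {g} e {a} {y} hg 3e∈S 3e+3∈S a∈S a≢0 y∈S y≢0 y≢a = begin
  3 * g                               ≤⟨ genus-by-classes S 0 (a % 3) (y % 3) (K e) (a + K e) (y + K e) hg covered ⟩
  K e + (a + K e) + (y + K e) + 6     ≡⟨ collect (K e) a y ⟩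
  3 * K e + 6 + a + y                 ∎
  where
  open ≤-Reasoning
  collect : ∀ k a y → k + (a + k) + (y + k) + 6 ≡ 3 * k + 6 + a + y
  collect = solve-∀
  below : ∀ {x L} → mem S x ≡ false → (L ≤ x → x ∈S S) → x < L
  below x∉S in-from-L = ≰⇒> (λ L≤x → mem-clash S (in-from-L L≤x) x∉S)
  covered : ∀ x → mem S x ≡ false → (x % 3 ≡ 0 × x < K e) ⊎ (x % 3 ≡ a % 3 × x < a + K e) ⊎
                                      (x % 3 ≡ y % 3 × x < y + K e)
  covered x x∉S with x % 3 ≟ 0 | x % 3 ≟ a % 3
  ... | yes x≡0 | _       =
    inj₁ (x≡0 , below x∉S (divisible-in S e 3 3e∈S 3e+3∈S x (m%n≡0⇒n∣m x 3 x≡0)))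
  ... | no _    | yes x≡a =
    inj₂ (inj₁ (x≡a , below x∉S (same-residue-in S e 3 3e∈S 3e+3∈S a∈S x≡a)))
  ... | no x≢0  | no x≢a  =
    inj₂ (inj₂ (x≡y , below x∉S (same-residue-in S e 3 3e∈S 3e+3∈S y∈S x≡y)))
    where
    x≡y : x % 3 ≡ y % 3
    x≡y = trans (third-residue (m%n<n x 3) (m%n<n a 3) x≢0 a≢0 x≢a)
                (sym (third-residue (m%n<n y 3) (m%n<n a 3) y≢0 a≢0 y≢a))

-- χ < 6γ bounds u₁ from above:  u < g + 3γ + 1 + ⌊(g)₃/2⌋ ≤ g + 3γ + 2.
χ-bound : ∀ γ g u → chi γ g u ℤ.< + (6 * γ) → u ≤ g + 3 * γ + 1
χ-bound γ g u χ<6γ = <⇒≤pred (≤-trans (ℤₚ.drop‿+<+ u<bound)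
  (≤-trans (+-monoʳ-≤ (g + 3 * γ + 1) e≤1) (≤-reflexive (+-comm (g + 3 * γ + 1) 1))))
  where
  e = (g % 3) / 2
  e≤1 : e ≤ 1
  e≤1 = /-monoˡ-≤ 2 (<⇒≤pred (m%n<n g 3))
  X = (+ g ℤ.- + (3 * γ)) ℤ.+ + 1 ℤ.+ + e
  cancel : ∀ (v x : ℤ.ℤ) → (v ℤ.- x) ℤ.+ x ≡ v
  cancel = ℤSolver.solve-∀
  collect : ∀ (G c E : ℤ.ℤ) → (c ℤ.+ c) ℤ.+ ((G ℤ.- c) ℤ.+ + 1 ℤ.+ E) ≡ G ℤ.+ c ℤ.+ + 1 ℤ.+ E
  collect = ℤSolver.solve-∀
  bound≡ : + (6 * γ) ℤ.+ X ≡ + (g + 3 * γ + 1 + e)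
  bound≡ = begin
    + (6 * γ) ℤ.+ X                       ≡⟨ cong (λ n → + n ℤ.+ X) (solve (γ ∷ [])) ⟩
    + (3 * γ + 3 * γ) ℤ.+ X               ≡⟨ cong (ℤ._+ X) (ℤₚ.pos-+ (3 * γ) (3 * γ)) ⟩
    (+ (3 * γ) ℤ.+ + (3 * γ)) ℤ.+ X       ≡⟨ collect (+ g) (+ (3 * γ)) (+ e) ⟩
    + g ℤ.+ + (3 * γ) ℤ.+ + 1 ℤ.+ + e     ≡⟨ cong (λ z → z ℤ.+ + 1 ℤ.+ + e) (ℤₚ.pos-+ g (3 * γ)) ⟨
    + (g + 3 * γ) ℤ.+ + 1 ℤ.+ + e         ≡⟨ cong (ℤ._+ + e) (ℤₚ.pos-+ (g + 3 * γ) 1) ⟨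
    + (g + 3 * γ + 1) ℤ.+ + e             ≡⟨ ℤₚ.pos-+ (g + 3 * γ + 1) e ⟨
    + (g + 3 * γ + 1 + e)                 ∎
    where open ≡-Reasoning
  u<bound : + u ℤ.< + (g + 3 * γ + 1 + e)
  u<bound = subst₂ ℤ._<_ (cancel (+ u) X) bound≡ (ℤₚ.+-monoˡ-< X χ<6γ)

-- The parameters of the exchange lemma for given γ, g and u₁ = a: the threshold
-- β = 3g − (3K + 6 + a) below which S has no element in the third class (K = K (2γ)),
-- the window width C, and the genus bound g₀.
threshold : ℕ → ℕ → ℕ → ℕ
threshold γ g a = 3 * g ∸ (3 * K (2 * γ) + 6 + a)

width : ℕ → ℕ
width γ = 3 * K (2 * γ) + 3 * γ + 7

g₀ : ℕ → ℕ
g₀ γ = width γ * width γ + 4 * K (2 * γ) + 6 * γ + 8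

parameters-fit : ∀ γ g a → g₀ γ ≤ g → a ≤ g + 3 * γ + 1 →
  a ≤ 2 * g × a + K (2 * γ) + width γ * width γ ≤ threshold γ g a × 2 * g ≤ threshold γ g a + width γ
parameters-fit γ g a g₀≤g a≤ = a≤2g , m+n≤o⇒m≤o∸n (a + k + c * c) budget , 2g≤β+C
  where
  open ≤-Reasoning
  k = K (2 * γ)
  c = width γ
  b = 3 * k + 6 + a
  β = threshold γ g a
  a≤2g : a ≤ 2 * g
  a≤2g = begin
    a                     ≤⟨ a≤ ⟩
    g + 3 * γ + 1         ≡⟨ +-assoc g (3 * γ) 1 ⟩
    g + (3 * γ + 1)       ≤⟨ +-monoʳ-≤ g (≤-trans (m≤m+n (3 * γ + 1) (c * c + 4 * k + 3 * γ + 7))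
                                                  (≤-trans (≤-reflexive (regroup (c * c) k γ)) g₀≤g)) ⟩
    g + g                 ≡⟨ cong (_+_ g) (+-identityʳ g) ⟨
    2 * g                 ∎
    where
    regroup : ∀ x k γ → 3 * γ + 1 + (x + 4 * k + 3 * γ + 7) ≡ x + 4 * k + 6 * γ + 8
    regroup = solve-∀
  budget : (a + k + c * c) + b ≤ 3 * g
  budget = begin
    (a + k + c * c) + (3 * k + 6 + a)               ≡⟨ split a k (c * c) ⟩
    (a + a) + (c * c + 4 * k + 6)                   ≤⟨ +-monoˡ-≤ _ (+-mono-≤ a≤ a≤) ⟩
    (g + 3 * γ + 1) + (g + 3 * γ + 1) + (c * c + 4 * k + 6)
                                                    ≡⟨ merge g γ k (c * c) ⟩
    (g + g) + (c * c + 4 * k + 6 * γ + 8)           ≤⟨ +-monoʳ-≤ (g + g) g₀≤g ⟩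
    (g + g) + g                                     ≡⟨ solve (g ∷ []) ⟩
    3 * g                                           ∎
    where
    split : ∀ a k x → (a + k + x) + (3 * k + 6 + a) ≡ (a + a) + (x + 4 * k + 6)
    split = solve-∀
    merge : ∀ g γ k x → (g + 3 * γ + 1) + (g + 3 * γ + 1) + (x + 4 * k + 6) ≡ (g + g) + (x + 4 * k + 6 * γ + 8)
    merge = solve-∀
  β+b≡3g : β + b ≡ 3 * g
  β+b≡3g = m∸n+n≡m (m+n≤o⇒n≤o (a + k + c * c) budget)
  2g≤β+C : 2 * g ≤ β + c
  2g≤β+C = +-cancelʳ-≤ b (2 * g) (β + c) (begin
    2 * g + (3 * k + 6 + a)             ≤⟨ +-monoʳ-≤ (2 * g) (+-monoʳ-≤ (3 * k + 6) a≤) ⟩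
    2 * g + (3 * k + 6 + (g + 3 * γ + 1)) ≡⟨ regroup g γ k ⟩
    3 * g + c                           ≡⟨ cong (_+ c) β+b≡3g ⟨
    β + b + c                           ≡⟨ xy∙z≈xz∙y β b c ⟩
    β + c + b                           ∎)
    where
    regroup : ∀ g γ k → 2 * g + (3 * k + 6 + (g + 3 * γ + 1)) ≡ 3 * g + (3 * k + 3 * γ + 7)
    regroup = solve-∀

inflection-decreases : ∀ γ g a j (S T : NumSemigroup) → g₀ γ ≤ g →
  HasGenus S g → HasGenus T g → (2 * γ * 3) ∈S S → ((2 * γ + 1) * 3) ∈S S →
  a ∈S S → a % 3 ≢ 0 → a ≤ g + 3 * γ + 1 →
  (∀ s → InSub S g 0 s → InSub T g 0 s) → StrictSub S (a % 3) T j g →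
  inflection T g < inflection S g
inflection-decreases γ g a j S T g₀≤g genusS genusT 6γ∈S 6γ+3∈S a∈S a≢0 a≤
                     S₀⊆T₀ (Sᵢ⊆Tⱼ , s₀ , (1≤s₀ , s₀≤2g , s₀∈T , s₀≡j) , s₀∉Sᵢ) =
  exchange S T (2 * g) β C s₀ (trans (countPos-genus S genusS) (sym (countPos-genus T genusT)))
           S∖T-large 2g≤β+C 1≤s₀ s₀≤2g s₀∈T s₀∉S
           (≤-trans (+-monoˡ-< (C * C) s₀<a+K) a+K+C²≤β)
  where
  β = threshold γ g a
  C = width γ
  fit = parameters-fit γ g a g₀≤g a≤
  a≤2g = proj₁ fit
  a+K+C²≤β = proj₁ (proj₂ fit)
  2g≤β+C = proj₂ (proj₂ fit)

  -- a ∈ S_i ⊆ T_j forces j = i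
  i≡j : a % 3 ≡ j
  i≡j = proj₂ (proj₂ (proj₂ (Sᵢ⊆Tⱼ a (n≢0⇒n>0 (λ a≡0 → a≢0 (cong (_% 3) a≡0)) , a≤2g , a∈S , refl))))

  s₀∉S : mem S s₀ ≡ false
  s₀∉S = Bool.¬-not (λ s₀∈S → s₀∉Sᵢ (1≤s₀ , s₀≤2g , s₀∈S , trans s₀≡j (sym i≡j)))

  -- s₀ is a gap of S in the class of a, so it lies below a + K
  s₀<a+K : s₀ < a + K (2 * γ)
  s₀<a+K = ≰⇒> (λ a+K≤s₀ → mem-clash S
    (same-residue-in S (2 * γ) 3 6γ∈S 6γ+3∈S a∈S (trans s₀≡j (sym i≡j)) a+K≤s₀) s₀∉S)

  -- S∖T lies in the third residue class, where S has no element below β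
  S∖T-large : ∀ s → 1 ≤ s → s ≤ 2 * g → s ∈S S → mem T s ≡ false → β ≤ s
  S∖T-large s 1≤s s≤2g s∈S s∉T with s % 3 ≟ 0 | s % 3 ≟ a % 3
  ... | yes s≡0 | _       =
    ⊥-elim (mem-clash T (proj₁ (proj₂ (proj₂ (S₀⊆T₀ s (1≤s , s≤2g , s∈S , s≡0))))) s∉T)
  ... | no _    | yes s≡i =
    ⊥-elim (mem-clash T (proj₁ (proj₂ (proj₂ (Sᵢ⊆Tⱼ s (1≤s , s≤2g , s∈S , s≡i))))) s∉T)
  ... | no s≢0  | no s≢i  =
    m≤n+o⇒m∸n≤o (3 * g) _ (third-class-large S (2 * γ) genusS 6γ∈S 6γ+3∈S a∈S a≢0 s∈S s≢0 s≢i)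

lemma2p5 : (γ : ℕ) → Σ ℕ λ g₀ → (g : ℕ) → g₀ ≤ g →
    (R₀ : ℕ → Set) (u₁ u₁' : ℕ) (S T : NumSemigroup) →
    InH γ g R₀ u₁ S → InH γ g R₀ u₁' T →
    (∀ P → InH γ g R₀ u₁ P → cardSub P g (u₁ % 3) ≤ cardSub S g (u₁ % 3)) →
    (∀ P → InH γ g R₀ u₁' P → cardSub P g (u₁' % 3) ≤ cardSub T g (u₁' % 3)) →
    chi γ g u₁ ℤ.< + (6 * γ) →
    StrictSub S (u₁ % 3) T (u₁' % 3) g →
    inflection T g < inflection S g
lemma2p5 γ = g₀ γ , λ where
  g g₀≤g R₀ u₁ u₁' S T ((_ , _ , 6γ∈S , 6γ+3∈S) , genusS , S₀≡R₀ , u₁∈S , u₁≢0 , _)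
    (_ , genusT , T₀≡R₀ , _) _ _ χ<6γ Sᵢ⊊Tⱼ →
    inflection-decreases γ g u₁ (u₁' % 3) S T g₀≤g genusS genusT 6γ∈S 6γ+3∈S u₁∈S u₁≢0
      (χ-bound γ g u₁ χ<6γ) (λ s s∈S₀ → proj₂ (T₀≡R₀ s) (proj₁ (S₀≡R₀ s) s∈S₀)) Sᵢ⊊Tⱼ
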